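{- There is a propagation-complete CNF encoding of the constraint $\mathsf{AtMostOne}'(x_1,\dots,x_n;z)$ using $2n + O(\sqrt{n})$ clauses and $O(\sqrt{n})$ auxiliary variables.
   Context: $\mathsf{AtMostOne}'(x_1,\dots,x_n;z)$ is the Boolean function of the input variables $x_1,\dots,x_n,z$ defined as $\mathsf{AtMostOne}(x_1,\dots,x_n)\wedge\bigwedge_{i\in[n]}(\overline{x_i}\vee z)$, where $\mathsf{AtMostOne}$ is true iff at most one argument is true. A CNF formula is a set of clauses; its size is its number of clauses. For a partial assignment $\tau$, $\varphi|_\tau$ deletes clauses satisfied by $\tau$ and literals falsified by $\tau$. A CNF $\varphi$ over $X\sqcup Y$ encodes $f$ (on inputs $X$) if for every assignment $\tau$ of $X$, $f(\tau)=\top$ iff $\varphi|_\tau$ is satisfiable; $Y$ are auxiliary variables. The encoding is propagation complete if for all literals $\ell_1,\dots,\ell_m$ over $X$, whenever $\varphi\wedge\bigwedge_{i<m}\ell_i\models\ell_m$, unit propagation from $\varphi\wedge\bigwedge_{i<m}\ell_i$ derives $\ell_m$ or the empty clause. -}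

module Defs where

open import Data.Bool using (Bool; true; false; if_then_else_)
open import Data.Nat using (ℕ)
open import Data.Fin using (Fin)
open import Data.Sum using (_⊎_; inj₁; inj₂)
open import Data.Product using (Σ; ∃; _×_)
open import Data.List using (List; []; _∷_; _++_; map; mapMaybe)
open import Data.List.Membership.Propositional using (_∈_)
open import Data.Maybe using (Maybe; just; nothing)
import Data.Maybe as Maybe
open import Relation.Binary.PropositionalEquality using (_≡_; _≢_)
open import Function using (_⇔_)

data Lit (V : Set) : Set where
  pos : V → Lit V
  neg : V → Lit V

Clause : Set → Set
Clause V = List (Lit V)

-- A CNF is a list of clauses; its size is its length.
CNF : Set → Set
CNF V = List (Clause V)

complement : {V : Set} → Lit V → Lit V
complement (pos v) = neg v
complement (neg v) = pos v

liftLit : {X Y : Set} → Lit X → Lit (X ⊎ Y)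
liftLit (pos x) = pos (inj₁ x)
liftLit (neg x) = neg (inj₁ x)

evalLit : {V : Set} → (V → Bool) → Lit V → Bool
evalLit α (pos v) = α v
evalLit α (neg v) = if α v then false else true

SatClause : {V : Set} → (V → Bool) → Clause V → Set
SatClause α C = Σ _ λ l → l ∈ C × evalLit α l ≡ true

Sat : {V : Set} → (V → Bool) → CNF V → Set
Sat α φ = ∀ C → C ∈ φ → SatClause α C

Satisfiable : {V : Set} → CNF V → Set
Satisfiable {V} φ = ∃ λ (α : V → Bool) → Sat α φ

Entails : {V : Set} → CNF V → Lit V → Set
Entails {V} φ l = (α : V → Bool) → Sat α φ → evalLit α l ≡ true

-- Restriction φ|τ by a total assignment τ of the X-variables:
-- delete clauses satisfied by τ and literals falsified by τ.
restrictClause : {X Y : Set} → (X → Bool) → Clause (X ⊎ Y) → Maybe (Clause Y)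
restrictClause τ [] = just []
restrictClause τ (pos (inj₁ a) ∷ c) = if τ a then nothing else restrictClause τ c
restrictClause τ (neg (inj₁ a) ∷ c) = if τ a then restrictClause τ c else nothing
restrictClause τ (pos (inj₂ y) ∷ c) = Maybe.map (pos y ∷_) (restrictClause τ c)
restrictClause τ (neg (inj₂ y) ∷ c) = Maybe.map (neg y ∷_) (restrictClause τ c)

restrict : {X Y : Set} → CNF (X ⊎ Y) → (X → Bool) → CNF Y
restrict φ τ = mapMaybe (restrictClause τ) φ

data UPDerives {V : Set} (φ : CNF V) : Lit V → Set where
  unit : ∀ {C l} → C ∈ φ → l ∈ C →
         (∀ l' → l' ∈ C → l' ≢ l → UPDerives φ (complement l')) →
         UPDerives φ l

UPConflict : {V : Set} → CNF V → Set
UPConflict φ = Σ _ λ C → C ∈ φ × (∀ l → l ∈ C → UPDerives φ (complement l))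

unitClauses : {V : Set} → List (Lit V) → CNF V
unitClauses ls = map (λ l → l ∷ []) ls

Encodes : {X Y : Set} → CNF (X ⊎ Y) → ((X → Bool) → Set) → Set
Encodes φ f = ∀ τ → (f τ ⇔ Satisfiable (restrict φ τ))

-- Propagation completeness (w.r.t. literals over the input variables X):
-- for literals ℓ₁..ℓ_{m-1} (the list ls) and ℓ_m (l) over X,
-- if φ ∧ ⋀ ls ⊨ l then unit propagation derives l or the empty clause.
PropagationComplete : {X Y : Set} → CNF (X ⊎ Y) → Set
PropagationComplete {X} {Y} φ =
  (ls : List (Lit X)) (l : Lit X) →
  let ψ = φ ++ unitClauses (map (liftLit {X} {Y}) ls) in
  Entails ψ (liftLit l) → UPDerives ψ (liftLit l) ⊎ UPConflict ψ

data InVar (n : ℕ) : Set where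
  x : Fin n → InVar n
  z : InVar n

AtMostOne′ : (n : ℕ) → (InVar n → Bool) → Set
AtMostOne′ n τ =
  (∀ i j → τ (x i) ≡ true → τ (x j) ≡ true → i ≡ j) ×
  (∀ i → τ (x i) ≡ true → τ z ≡ true)

-- Place the n inputs in distinct cells of a k × k grid with n ≤ k² ≤ 4n. Each input implies the
-- variable of its row and of its column (2n clauses), every row variable implies z, and a sequential
-- counter on the row variables and one on the column variables (3k − 2 clauses each) allow at most
-- one active row and one active column: 4k auxiliary variables and 2n + 7k − 4 clauses in total.
--
-- Two distinct inputs differ in their row or their column, so unit propagation from xᵢ refutes every
-- other xⱼ and derives z, and from ¬z it refutes every xⱼ: whenever a literal is derived, so is the
-- complement of every literal incompatible with it. This gives propagation completeness because
-- AtMostOne′ is determined by incompatible pairs: a set of literals containing no such pair is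
-- satisfied by making an input true iff it is asserted, and z true iff ¬z is not asserted.
module Submission where

open import Defs
open import Data.Nat using (ℕ; zero; suc; _+_; _*_; _∸_; _≤_; z≤n; s≤s; s≤s⁻¹; _≤?_)
open import Data.Nat.Properties
  using (*-suc; m+n∸m≡n; ≤-trans; ≤-antisym; ≰⇒>; n≤1+n; m≤m+n; *-mono-≤; *-monoˡ-≤; *-monoʳ-≤;
         module ≤-Reasoning)
open import Data.Nat.Tactic.RingSolver using (solve-∀)
open import Data.Fin using (Fin; #_)
import Data.Fin as F
import Data.Fin.Properties as Fin
open import Data.Bool using (Bool; true; false; not; _∧_; _∨_; if_then_else_)
open import Data.Bool.Properties using (∨-zeroʳ; ∧-conicalˡ; ∧-conicalʳ)
open import Data.Empty using (⊥; ⊥-elim)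
open import Data.Unit using (⊤; tt)
open import Data.Sum using (_⊎_; inj₁; inj₂) renaming ([_,_]′ to [_,_])
open import Data.Product using (Σ; ∃; ∃₂; ∃-syntax; _×_; _,_; proj₁; proj₂; uncurry)
open import Data.Product.Properties using (×-≡,≡→≡)
open import Data.List using (List; []; _∷_; _++_; length; map; mapMaybe; tabulate)
open import Data.List.Properties using (length-++; length-tabulate)
open import Data.List.Relation.Unary.All as All using (All; []; _∷_)
import Data.List.Relation.Unary.All.Properties as All
open import Data.List.Relation.Unary.Any as Any using (Any; here; there)
open import Data.List.Membership.Propositional using (_∈_; find; lose)
open import Data.List.Membership.Propositional.Properties
  using (∈-map⁺; ∈-++⁺ˡ; ∈-++⁺ʳ; ∈-tabulate⁺)
open import Data.List.Relation.Binary.Subset.Propositional using (_⊆_)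
open import Data.Maybe using (Maybe; just; nothing; maybe′)
import Data.Maybe.Relation.Unary.All as Maybe
open import Function using (_∘_; id; _⇔_; mk⇔; Equivalence)
open import Function.Definitions using (Injective)
open import Relation.Nullary using (¬_; ¬?; Dec; yes; no; does)
import Relation.Nullary.Decidable as Dec
open import Relation.Nullary.Decidable using (dec-true)
open import Relation.Binary.Definitions using (DecidableEquality)
open import Relation.Binary.PropositionalEquality
  using (_≡_; _≢_; refl; sym; trans; cong; cong₂; subst)

neg-holds : ∀ {b} → b ≡ false → (if b then false else true) ≡ true
neg-holds refl = refl

module _ {V : Set} where

  Holds : (V → Bool) → Lit V → Set
  Holds α l = evalLit α l ≡ true

  evalLit-complement : ∀ α l → Holds α l → ¬ Holds α (complement l)
  evalLit-complement α (pos v) with α v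
  ... | true  = λ _ ()
  ... | false = λ ()
  evalLit-complement α (neg v) with α v
  ... | true  = λ ()
  ... | false = λ _ ()

  any⇒satClause : ∀ {α : V → Bool} {C} → Any (Holds α) C → SatClause α C
  any⇒satClause = find

  satClause⇒any : ∀ {α : V → Bool} {C} → SatClause α C → Any (Holds α) C
  satClause⇒any (_ , l∈C , h) = lose l∈C h

  all⇒sat : ∀ {α : V → Bool} {φ} → All (SatClause α) φ → Sat α φ
  all⇒sat a _ = All.lookup a

  sat⇒all : ∀ {α : V → Bool} {φ} → Sat α φ → All (SatClause α) φ
  sat⇒all s = All.tabulate λ {C} → s C

  implication-holds : ∀ {α : V → Bool} {u v} →
                      (α u ≡ true → α v ≡ true) → SatClause α (neg u ∷ pos v ∷ [])
  implication-holds {α} {u} h with α u in e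
  ... | true  = _ , there (here refl) , h refl
  ... | false = _ , here refl , neg-holds e

  exclusion-holds : ∀ {α : V → Bool} {u v} →
                    (α u ≡ true → α v ≡ false) → SatClause α (neg u ∷ neg v ∷ [])
  exclusion-holds {α} {u} h with α u in e
  ... | true  = _ , there (here refl) , neg-holds (h refl)
  ... | false = _ , here refl , neg-holds e

module _ {V : Set} {ψ : CNF V} where

  unit-derives : ∀ {l} → (l ∷ []) ∈ ψ → UPDerives ψ l
  unit-derives c = unit c (here refl) λ { _ (here refl) l≢l → ⊥-elim (l≢l refl) }

  unit-conflict : ∀ {l} → (l ∷ []) ∈ ψ → UPDerives ψ (complement l) → UPConflict ψ
  unit-conflict c d = _ , c , λ { _ (here refl) → d }

  propagateʳ : ∀ {a b} → (a ∷ b ∷ []) ∈ ψ → UPDerives ψ (complement a) → UPDerives ψ b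
  propagateʳ c d = unit c (there (here refl)) λ
    { _ (here refl) _ → d
    ; _ (there (here refl)) b≢b → ⊥-elim (b≢b refl) }

  propagateˡ : ∀ {a b} → (a ∷ b ∷ []) ∈ ψ → UPDerives ψ (complement b) → UPDerives ψ a
  propagateˡ c d = unit c (here refl) λ
    { _ (here refl) a≢a → ⊥-elim (a≢a refl)
    ; _ (there (here refl)) _ → d }

  UPDerives-sound : ∀ {α l} → Sat α ψ → UPDerives ψ l → Holds α l
  UPDerives-sound {α} {l} s (unit {C} C∈ψ l∈C rest) with evalLit α l in e
  ... | true  = refl
  ... | false with s C C∈ψ
  ...   | l′ , l′∈C , h =
    ⊥-elim (evalLit-complement α l′ h (UPDerives-sound s (rest l′ l′∈C l′≢l)))
    where
    l′≢l : l′ ≢ l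
    l′≢l refl with () ← trans (sym h) e

All-maybe′⁻ : ∀ {B : Set} {P : B → Set} m {bs} →
              All P (maybe′ _∷_ id m bs) → Maybe.All P m × All P bs
All-maybe′⁻ nothing  ps       = Maybe.nothing , ps
All-maybe′⁻ (just _) (p ∷ ps) = Maybe.just p , ps

All-mapMaybe⁻ : ∀ {A B : Set} {P : B → Set} (f : A → Maybe B) xs →
                All P (mapMaybe f xs) → All (Maybe.All P ∘ f) xs
All-mapMaybe⁻ f []       []  = []
All-mapMaybe⁻ f (a ∷ as) ps with All-maybe′⁻ (f a) ps
... | p , ps′ = p ∷ All-mapMaybe⁻ f as ps′

module _ {X Y : Set} (τ : X → Bool) (α : Y → Bool) where

  restrictClause-complete : ∀ C → Any (Holds [ τ , α ]) C →
                            Maybe.All (Any (Holds α)) (restrictClause τ C)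
  restrictClause-complete (pos (inj₁ a) ∷ C) h with τ a in e | h
  ... | true  | _        = Maybe.nothing
  ... | false | here τa  = ⊥-elim (evalLit-complement τ (pos a) τa (neg-holds e))
  ... | false | there h′ = restrictClause-complete C h′
  restrictClause-complete (neg (inj₁ a) ∷ C) h with τ a in e | h
  ... | false | _        = Maybe.nothing
  ... | true  | here ¬τa = ⊥-elim (evalLit-complement τ (pos a) e ¬τa)
  ... | true  | there h′ = restrictClause-complete C h′
  restrictClause-complete (pos (inj₂ y) ∷ C) h with restrictClause τ C | restrictClause-complete C | h
  ... | nothing | _  | _        = Maybe.nothing
  ... | just _  | _  | here αy  = Maybe.just (here αy)
  ... | just _  | ih | there h′ = Maybe.just (there (Maybe.drop-just (ih h′)))
  restrictClause-complete (neg (inj₂ y) ∷ C) h with restrictClause τ C | restrictClause-complete C | h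
  ... | nothing | _  | _        = Maybe.nothing
  ... | just _  | _  | here ¬αy = Maybe.just (here ¬αy)
  ... | just _  | ih | there h′ = Maybe.just (there (Maybe.drop-just (ih h′)))

  restrictClause-sound : ∀ C → Maybe.All (Any (Holds α)) (restrictClause τ C) →
                         Any (Holds [ τ , α ]) C
  restrictClause-sound [] (Maybe.just ())
  restrictClause-sound (pos (inj₁ a) ∷ C) h with τ a in e
  ... | true  = here e
  ... | false = there (restrictClause-sound C h)
  restrictClause-sound (neg (inj₁ a) ∷ C) h with τ a in e
  ... | true  = there (restrictClause-sound C h)
  ... | false = here (neg-holds e)
  restrictClause-sound (pos (inj₂ y) ∷ C) h with restrictClause τ C | restrictClause-sound C | h
  ... | nothing | ih | _                      = there (ih Maybe.nothing)
  ... | just _  | _  | Maybe.just (here αy)   = here αy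
  ... | just _  | ih | Maybe.just (there h′)  = there (ih (Maybe.just h′))
  restrictClause-sound (neg (inj₂ y) ∷ C) h with restrictClause τ C | restrictClause-sound C | h
  ... | nothing | ih | _                      = there (ih Maybe.nothing)
  ... | just _  | _  | Maybe.just (here ¬αy)  = here ¬αy
  ... | just _  | ih | Maybe.just (there h′)  = there (ih (Maybe.just h′))

  restrict-sat : ∀ φ → Sat α (restrict φ τ) ⇔ Sat [ τ , α ] φ
  restrict-sat φ = mk⇔
    (λ s → all⇒sat (All.map (clause-sound _) (All-mapMaybe⁻ (restrictClause τ) φ (sat⇒all s))))
    (λ s → all⇒sat (All.All-catMaybes⁺ (All.map⁺ (All.map (clause-complete _) (sat⇒all s)))))
    where
    clause-sound : ∀ C → Maybe.All (SatClause α) (restrictClause τ C) → SatClause [ τ , α ] C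
    clause-sound C = any⇒satClause ∘ restrictClause-sound C ∘ Maybe.map satClause⇒any
    clause-complete : ∀ C → SatClause [ τ , α ] C → Maybe.All (SatClause α) (restrictClause τ C)
    clause-complete C = Maybe.map any⇒satClause ∘ restrictClause-complete C ∘ satClause⇒any

module _ {X Y : Set} where

  encodes-byModels : ∀ {φ : CNF (X ⊎ Y)} {f} →
    (∀ τ → f τ → ∃ λ α → Sat [ τ , α ] φ) → (∀ τ α → Sat [ τ , α ] φ → f τ) → Encodes φ f
  encodes-byModels {φ} extend project τ = mk⇔
    (λ fτ → let α , s = extend τ fτ in α , Equivalence.from (restrict-sat τ α φ) s)
    (λ (α , s) → project τ α (Equivalence.to (restrict-sat τ α φ) s))

  assume : CNF (X ⊎ Y) → List (Lit X) → CNF (X ⊎ Y)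
  assume φ ls = φ ++ unitClauses (map liftLit ls)

  evalLit-liftLit : ∀ (τ : X → Bool) (α : Y → Bool) l → evalLit [ τ , α ] (liftLit l) ≡ evalLit τ l
  evalLit-liftLit τ α (pos _) = refl
  evalLit-liftLit τ α (neg _) = refl

  complement-liftLit-complement : ∀ l → complement (liftLit {X} {Y} (complement l)) ≡ liftLit l
  complement-liftLit-complement (pos _) = refl
  complement-liftLit-complement (neg _) = refl

  assumed-unit : ∀ φ {ls l} → l ∈ ls → (liftLit l ∷ []) ∈ assume φ ls
  assumed-unit φ l∈ls = ∈-++⁺ʳ φ (∈-map⁺ (_∷ []) (∈-map⁺ liftLit l∈ls))

  assume-sat : ∀ {τ α φ ls} → Sat [ τ , α ] φ → (∀ {l} → l ∈ ls → Holds τ l) →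
               Sat [ τ , α ] (assume φ ls)
  assume-sat {τ} {α} {φ} {ls} s τ⊨ls =
    all⇒sat (All.++⁺ (sat⇒all s) (All.map⁺ (All.map⁺ (All.tabulate unit-sat))))
    where
    unit-sat : ∀ {l} → l ∈ ls → SatClause [ τ , α ] (liftLit l ∷ [])
    unit-sat {l} l∈ls = _ , here refl , trans (evalLit-liftLit τ α l) (τ⊨ls l∈ls)

module Incompatibility {X : Set} (_#_ : Lit X → Lit X → Set) where

  HasIncompatiblePair : List (Lit X) → Set
  HasIncompatiblePair L = ∃₂ λ a b → a ∈ L × b ∈ L × a # b

  hasIncompatiblePair? : (∀ a b → Dec (a # b)) → ∀ L → Dec (HasIncompatiblePair L)
  hasIncompatiblePair? _#?_ L = Dec.map′
    (λ p → let a , a∈L , q = find p ; b , b∈L , a#b = find q in a , b , a∈L , b∈L , a#b)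
    (λ (a , b , a∈L , b∈L , a#b) → lose a∈L (lose b∈L a#b))
    (Any.any? (λ a → Any.any? (a #?_) L) L)

  Consistent : (X → Bool) → Set
  Consistent τ = ∀ {a b} → a # b → Holds τ a → ¬ Holds τ b

  PropagatesIncompatibility : ∀ {Y} → CNF (X ⊎ Y) → Set
  PropagatesIncompatibility φ = ∀ ls {a b} → a # b →
    UPDerives (assume φ ls) (liftLit a) → UPDerives (assume φ ls) (complement (liftLit b))

  module _ {Y : Set} {φ : CNF (X ⊎ Y)} (propagates : PropagatesIncompatibility φ) where

    models-consistent : ∀ {τ α} → Sat [ τ , α ] φ → Consistent τ
    models-consistent {τ} {α} s {a} {b} a#b τa τb =
      evalLit-complement [ τ , α ] (liftLit b) (trans (evalLit-liftLit τ α b) τb)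
        (UPDerives-sound (assume-sat s λ { (here refl) → τa })
          (propagates (a ∷ []) a#b (unit-derives (assumed-unit φ (here refl)))))

    assumption-forces : ∀ {ls c l} → c ∈ ls → c # complement l → UPDerives (assume φ ls) (liftLit l)
    assumption-forces {ls} {l = l} c∈ls c#l =
      subst (UPDerives (assume φ ls)) (complement-liftLit-complement l)
        (propagates ls c#l (unit-derives (assumed-unit φ c∈ls)))

    -- Apply the dichotomy to ¬l ∷ ls: a model refutes the entailment of l, and an incompatible
    -- pair propagates to l if it involves ¬l, and to a conflict otherwise.
    propagationComplete : ∀ {f} → Encodes φ f → (∀ {a} → ¬ a # a) → (∀ {a b} → a # b → b # a) →
      (∀ L → HasIncompatiblePair L ⊎ ∃ λ τ → f τ × (∀ {l} → l ∈ L → Holds τ l)) →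
      PropagationComplete φ
    propagationComplete encodes irrefl sym# pair-or-model ls l entails with pair-or-model (complement l ∷ ls)
    ... | inj₂ (τ , fτ , τ⊨) with Equivalence.to (encodes τ) fτ
    ...   | α , s = ⊥-elim (evalLit-complement τ l τl (τ⊨ (here refl)))
      where
      τl : Holds τ l
      τl = trans (sym (evalLit-liftLit τ α l))
             (entails [ τ , α ] (assume-sat (Equivalence.to (restrict-sat τ α φ) s) (τ⊨ ∘ there)))
    propagationComplete encodes irrefl sym# pair-or-model ls l entails
      | inj₁ (a , b , a∈ , b∈ , a#b) with a∈ | b∈
    ... | here refl  | here refl  = ⊥-elim (irrefl a#b)
    ... | here refl  | there b∈ls = inj₁ (assumption-forces b∈ls (sym# a#b))
    ... | there a∈ls | here refl  = inj₁ (assumption-forces a∈ls a#b)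
    ... | there a∈ls | there b∈ls =
      inj₂ (unit-conflict (assumed-unit φ b∈ls) (propagates ls a#b (unit-derives (assumed-unit φ a∈ls))))

module _ {n : ℕ} where

  x-injective : ∀ {i j : Fin n} → x i ≡ x j → i ≡ j
  x-injective refl = refl

  _≟ᵛ_ : DecidableEquality (InVar n)
  x i ≟ᵛ x j = Dec.map′ (cong x) x-injective (i F.≟ j)
  x _ ≟ᵛ z   = no λ ()
  z   ≟ᵛ x _ = no λ ()
  z   ≟ᵛ z   = yes refl

  _≟ˡ_ : DecidableEquality (Lit (InVar n))
  pos u ≟ˡ pos v = Dec.map′ (cong pos) (λ { refl → refl }) (u ≟ᵛ v)
  neg u ≟ˡ neg v = Dec.map′ (cong neg) (λ { refl → refl }) (u ≟ᵛ v)
  pos _ ≟ˡ neg _ = no λ ()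
  neg _ ≟ˡ pos _ = no λ ()

  open import Data.List.Membership.DecPropositional _≟ˡ_ using (_∈?_)

  Incompatible : Lit (InVar n) → Lit (InVar n) → Set
  Incompatible (pos (x i)) (pos (x j)) = i ≢ j
  Incompatible (pos (x i)) (neg (x j)) = i ≡ j
  Incompatible (neg (x i)) (pos (x j)) = i ≡ j
  Incompatible (pos (x _)) (neg z)     = ⊤
  Incompatible (neg z)     (pos (x _)) = ⊤
  Incompatible (pos z)     (neg z)     = ⊤
  Incompatible (neg z)     (pos z)     = ⊤
  Incompatible _           _           = ⊥

  incompatible? : ∀ a b → Dec (Incompatible a b)
  incompatible? (pos (x i)) (pos (x j)) = ¬? (i F.≟ j)
  incompatible? (pos (x i)) (neg (x j)) = i F.≟ j
  incompatible? (neg (x i)) (pos (x j)) = i F.≟ j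
  incompatible? (pos (x _)) (neg z)     = yes tt
  incompatible? (neg z)     (pos (x _)) = yes tt
  incompatible? (pos z)     (neg z)     = yes tt
  incompatible? (neg z)     (pos z)     = yes tt
  incompatible? (pos (x _)) (pos z)     = no λ ()
  incompatible? (pos z)     (pos _)     = no λ ()
  incompatible? (pos z)     (neg (x _)) = no λ ()
  incompatible? (neg (x _)) (neg _)     = no λ ()
  incompatible? (neg (x _)) (pos z)     = no λ ()
  incompatible? (neg z)     (neg _)     = no λ ()

  incompatible-irrefl : ∀ {a} → ¬ Incompatible a a
  incompatible-irrefl {pos (x i)} i≢i = i≢i refl
  incompatible-irrefl {pos z}     ()
  incompatible-irrefl {neg (x _)} ()
  incompatible-irrefl {neg z}     ()

  incompatible-sym : ∀ {a b} → Incompatible a b → Incompatible b a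
  incompatible-sym {pos (x i)} {pos (x j)} i≢j = i≢j ∘ sym
  incompatible-sym {pos (x i)} {neg (x j)} i≡j = sym i≡j
  incompatible-sym {neg (x i)} {pos (x j)} i≡j = sym i≡j
  incompatible-sym {pos (x _)} {neg z}     _   = tt
  incompatible-sym {neg z}     {pos (x _)} _   = tt
  incompatible-sym {pos z}     {neg z}     _   = tt
  incompatible-sym {neg z}     {pos z}     _   = tt

  open Incompatibility Incompatible using (HasIncompatiblePair; hasIncompatiblePair?; Consistent)

  consistent⇒atMostOne′ : ∀ {τ} → Consistent τ → AtMostOne′ n τ
  consistent⇒atMostOne′ {τ} consistent = at-most-one , implies-z
    where
    at-most-one : ∀ i j → τ (x i) ≡ true → τ (x j) ≡ true → i ≡ j
    at-most-one i j τi τj with i F.≟ j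
    ... | yes i≡j = i≡j
    ... | no  i≢j = ⊥-elim (consistent {pos (x i)} {pos (x j)} i≢j τi τj)
    implies-z : ∀ i → τ (x i) ≡ true → τ z ≡ true
    implies-z i τi with τ z in e
    ... | true  = refl
    ... | false = ⊥-elim (consistent {pos (x i)} {neg z} tt τi (neg-holds e))

  canonical : List (Lit (InVar n)) → InVar n → Bool
  canonical L (x j) = does (pos (x j) ∈? L)
  canonical L z     = not (does (neg z ∈? L))

  module _ {L : List (Lit (InVar n))} (no-pair : ¬ HasIncompatiblePair L) where

    private
      excluded : ∀ {a b} → a ∈ L → b ∈ L → ¬ Incompatible a b
      excluded a∈L b∈L a#b = no-pair (_ , _ , a∈L , b∈L , a#b)

      input-assumed : ∀ {j} → Holds (canonical L) (pos (x j)) → pos (x j) ∈ L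
      input-assumed {j} h with pos (x j) ∈? L
      ... | yes p = p

      ¬z-assumed : Holds (canonical L) (neg z) → neg z ∈ L
      ¬z-assumed h with neg z ∈? L
      ... | yes p = p

    canonical-consistent : Consistent (canonical L)
    canonical-consistent {pos (x i)} {pos (x j)} i≢j hi hj = excluded (input-assumed hi) (input-assumed hj) i≢j
    canonical-consistent {pos (x i)} {neg (x i)} refl   = evalLit-complement (canonical L) (pos (x i))
    canonical-consistent {neg (x i)} {pos (x i)} refl   = evalLit-complement (canonical L) (neg (x i))
    canonical-consistent {pos (x i)} {neg z}     _ hi h = excluded (input-assumed hi) (¬z-assumed h) tt
    canonical-consistent {neg z}     {pos (x i)} _ h hi = excluded (¬z-assumed h) (input-assumed hi) tt
    canonical-consistent {pos z}     {neg z}     _      = evalLit-complement (canonical L) (pos z)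
    canonical-consistent {neg z}     {pos z}     _      = evalLit-complement (canonical L) (neg z)

    canonical-satisfies : ∀ {l} → l ∈ L → Holds (canonical L) l
    canonical-satisfies {pos (x j)} l∈L with pos (x j) ∈? L
    ... | yes _   = refl
    ... | no  l∉L = ⊥-elim (l∉L l∈L)
    canonical-satisfies {neg (x j)} l∈L with pos (x j) ∈? L
    ... | yes p = ⊥-elim (excluded p l∈L refl)
    ... | no  _ = refl
    canonical-satisfies {pos z} l∈L with neg z ∈? L
    ... | yes p = ⊥-elim (excluded l∈L p tt)
    ... | no  _ = refl
    canonical-satisfies {neg z} l∈L with neg z ∈? L
    ... | yes _   = refl
    ... | no  l∉L = ⊥-elim (l∉L l∈L)

  incompatiblePair-or-model : ∀ L →
    HasIncompatiblePair L ⊎ ∃ λ τ → AtMostOne′ n τ × (∀ {l} → l ∈ L → Holds τ l)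
  incompatiblePair-or-model L with hasIncompatiblePair? incompatible? L
  ... | yes pair    = inj₁ pair
  ... | no  no-pair =
    inj₂ (canonical L , consistent⇒atMostOne′ (canonical-consistent no-pair) , canonical-satisfies no-pair)

AtMostOneTrue : {A : Set} → (A → Bool) → Set
AtMostOneTrue p = ∀ i j → p i ≡ true → p j ≡ true → i ≡ j

anyᶠ : ∀ {k} → (Fin k → Bool) → Bool
anyᶠ {zero}  _ = false
anyᶠ {suc k} p = p F.zero ∨ anyᶠ (p ∘ F.suc)

anyᶠ-intro : ∀ {k} (p : Fin k → Bool) i → p i ≡ true → anyᶠ p ≡ true
anyᶠ-intro p F.zero    e = cong (_∨ anyᶠ (p ∘ F.suc)) e
anyᶠ-intro p (F.suc i) e = trans (cong (p F.zero ∨_) (anyᶠ-intro (p ∘ F.suc) i e)) (∨-zeroʳ (p F.zero))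

anyᶠ-elim : ∀ {k} (p : Fin k → Bool) → anyᶠ p ≡ true → ∃ λ i → p i ≡ true
anyᶠ-elim {suc k} p e with p F.zero in p₀
... | true  = F.zero , p₀
... | false = let i , pi = anyᶠ-elim (p ∘ F.suc) e in F.suc i , pi

suffixAny : ∀ {k} → (Fin k → Bool) → Fin k → Bool
suffixAny p F.zero    = anyᶠ p
suffixAny p (F.suc t) = suffixAny (p ∘ F.suc) t

module _ {n k : ℕ} (p : Fin n → Bool) (f : Fin n → Fin k) where

  hits : Fin k → Bool
  hits a = anyᶠ λ i → p i ∧ does (f i F.≟ a)

  hits-intro : ∀ i → p i ≡ true → hits (f i) ≡ true
  hits-intro i e = anyᶠ-intro _ i (cong₂ _∧_ e (dec-true (f i F.≟ f i) refl))

  hits-elim : ∀ {a} → hits a ≡ true → ∃ λ i → p i ≡ true × f i ≡ a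
  hits-elim {a} e with anyᶠ-elim _ e
  ... | i , e′ with f i F.≟ a
  ...   | yes fi≡a = i , ∧-conicalˡ _ _ e′ , fi≡a
  ...   | no  _ with () ← ∧-conicalʳ (p i) _ e′

  hits-atMostOne : AtMostOneTrue p → AtMostOneTrue hits
  hits-atMostOne at-most-one a b ha hb with hits-elim ha | hits-elim hb
  ... | i , pi , refl | j , pj , refl = cong f (at-most-one i j pi pj)

module _ {V : Set} where

  -- Sinz's sequential counter read from the right: S t stands for P t ∨ P (t + 1) ∨ ⋯
  sequential : ∀ k′ → (P S : Fin (suc k′) → V) → CNF V
  sequential zero     P S = (neg (P F.zero) ∷ pos (S F.zero) ∷ []) ∷ []
  sequential (suc k′) P S =
      (neg (P F.zero) ∷ pos (S F.zero) ∷ [])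
    ∷ (neg (S (F.suc F.zero)) ∷ pos (S F.zero) ∷ [])
    ∷ (neg (S (F.suc F.zero)) ∷ neg (P F.zero) ∷ [])
    ∷ sequential k′ (P ∘ F.suc) (S ∘ F.suc)

  length-sequential : ∀ k′ (P S : Fin (suc k′) → V) → length (sequential k′ P S) ≡ suc (3 * k′)
  length-sequential zero     P S = refl
  length-sequential (suc k′) P S =
    trans (cong (3 +_) (length-sequential k′ (P ∘ F.suc) (S ∘ F.suc))) (cong suc (sym (*-suc 3 k′)))

  sequential-sat : ∀ {k′} (P S : Fin (suc k′) → V) {γ : V → Bool} (p : Fin (suc k′) → Bool) →
    (∀ t → γ (P t) ≡ p t) → AtMostOneTrue p → (∀ t → γ (S t) ≡ suffixAny p t) →
    All (SatClause γ) (sequential k′ P S)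
  sequential-sat {zero} P S p γP _ γS =
    implication-holds (λ e → trans (γS F.zero) (cong (_∨ false) (trans (sym (γP F.zero)) e))) ∷ []
  sequential-sat {suc k′} P S {γ} p γP at-most-one γS =
      implication-holds P₀⇒S₀ ∷ implication-holds S₁⇒S₀ ∷ exclusion-holds S₁⇒¬P₀
    ∷ sequential-sat (P ∘ F.suc) (S ∘ F.suc) (p ∘ F.suc) (γP ∘ F.suc)
        (λ i j pi pj → Fin.suc-injective (at-most-one (F.suc i) (F.suc j) pi pj)) (γS ∘ F.suc)
    where
    later : γ (S (F.suc F.zero)) ≡ true → anyᶠ (p ∘ F.suc) ≡ true
    later = trans (sym (γS (F.suc F.zero)))
    P₀⇒S₀ : γ (P F.zero) ≡ true → γ (S F.zero) ≡ true
    P₀⇒S₀ e = trans (γS F.zero) (cong (_∨ anyᶠ (p ∘ F.suc)) (trans (sym (γP F.zero)) e))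
    S₁⇒S₀ : γ (S (F.suc F.zero)) ≡ true → γ (S F.zero) ≡ true
    S₁⇒S₀ e = trans (γS F.zero) (trans (cong (p F.zero ∨_) (later e)) (∨-zeroʳ (p F.zero)))
    S₁⇒¬P₀ : γ (S (F.suc F.zero)) ≡ true → γ (P F.zero) ≡ false
    S₁⇒¬P₀ e with anyᶠ-elim (p ∘ F.suc) (later e) | γ (P F.zero) in p₀
    ... | _ , _  | false = refl
    ... | i , pi | true with () ← at-most-one F.zero (F.suc i) (trans (sym (γP F.zero)) p₀) pi

module _ {V : Set} {ψ : CNF V} where

  private
    tail⊆ : ∀ {k′} (P S : Fin (suc (suc k′)) → V) → sequential (suc k′) P S ⊆ ψ →
            sequential k′ (P ∘ F.suc) (S ∘ F.suc) ⊆ ψ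
    tail⊆ _ _ sub = sub ∘ there ∘ there ∘ there

    head∈ : ∀ {k′} {P S : Fin (suc k′) → V} →
            (neg (P F.zero) ∷ pos (S F.zero) ∷ []) ∈ sequential k′ P S
    head∈ {zero}  = here refl
    head∈ {suc _} = here refl

  sequential-P⇒S₀ : ∀ {k′} (P S : Fin (suc k′) → V) → sequential k′ P S ⊆ ψ →
                    ∀ a → UPDerives ψ (pos (P a)) → UPDerives ψ (pos (S F.zero))
  sequential-P⇒S₀ P S sub F.zero d = propagateʳ (sub head∈) d
  sequential-P⇒S₀ {suc k′} P S sub (F.suc a) d =
    propagateʳ (sub (there (here refl))) (sequential-P⇒S₀ (P ∘ F.suc) (S ∘ F.suc) (tail⊆ P S sub) a d)

  sequential-¬S₀⇒¬P : ∀ {k′} (P S : Fin (suc k′) → V) → sequential k′ P S ⊆ ψ →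
                      UPDerives ψ (neg (S F.zero)) → ∀ b → UPDerives ψ (neg (P b))
  sequential-¬S₀⇒¬P P S sub d F.zero = propagateˡ (sub head∈) d
  sequential-¬S₀⇒¬P {suc k′} P S sub d (F.suc b) =
    sequential-¬S₀⇒¬P (P ∘ F.suc) (S ∘ F.suc) (tail⊆ P S sub)
      (propagateˡ (sub (there (here refl))) d) b

  sequential-atMostOne : ∀ {k′} (P S : Fin (suc k′) → V) → sequential k′ P S ⊆ ψ →
                         ∀ {a b} → a ≢ b → UPDerives ψ (pos (P a)) → UPDerives ψ (neg (P b))
  sequential-atMostOne P S _ {F.zero} {F.zero} a≢b _ = ⊥-elim (a≢b refl)
  sequential-atMostOne {suc k′} P S sub {F.zero} {F.suc b} _ d =
    sequential-¬S₀⇒¬P (P ∘ F.suc) (S ∘ F.suc) (tail⊆ P S sub)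
      (propagateˡ (sub (there (there (here refl)))) d) b
  sequential-atMostOne {suc k′} P S sub {F.suc a} {F.zero} _ d =
    propagateʳ (sub (there (there (here refl))))
      (sequential-P⇒S₀ (P ∘ F.suc) (S ∘ F.suc) (tail⊆ P S sub) a d)
  sequential-atMostOne {suc k′} P S sub {F.suc a} {F.suc b} a≢b d =
    sequential-atMostOne (P ∘ F.suc) (S ∘ F.suc) (tail⊆ P S sub) (a≢b ∘ cong F.suc) d

module GridEncoding {n k′ : ℕ} (cell : Fin n → Fin (suc k′) × Fin (suc k′))
                    (cell-injective : Injective _≡_ _≡_ cell) where

  Var : Set
  Var = InVar n ⊎ Fin (4 * suc k′)

  row col : Fin n → Fin (suc k′)
  row = proj₁ ∘ cell
  col = proj₂ ∘ cell

  input : Fin n → Var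
  input i = inj₁ (x i)

  output : Var
  output = inj₁ z

  auxVar : Fin 4 → Fin (suc k′) → Var
  auxVar g a = inj₂ (F.combine g a)

  rowVar colVar rowSuffix colSuffix : Fin (suc k′) → Var
  rowVar    = auxVar (# 0)
  colVar    = auxVar (# 1)
  rowSuffix = auxVar (# 2)
  colSuffix = auxVar (# 3)

  rowClause colClause : Fin n → Clause Var
  rowClause i = neg (input i) ∷ pos (rowVar (row i)) ∷ []
  colClause i = neg (input i) ∷ pos (colVar (col i)) ∷ []

  outputClause : Fin (suc k′) → Clause Var
  outputClause a = neg (rowVar a) ∷ pos output ∷ []

  rowsAtMostOne colsAtMostOne : CNF Var
  rowsAtMostOne = sequential k′ rowVar rowSuffix
  colsAtMostOne = sequential k′ colVar colSuffix

  φ : CNF Var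
  φ = tabulate rowClause ++ tabulate colClause ++ tabulate outputClause ++ rowsAtMostOne ++ colsAtMostOne

  rowClause∈ : ∀ i → rowClause i ∈ φ
  rowClause∈ i = ∈-++⁺ˡ (∈-tabulate⁺ i)

  colClause∈ : ∀ i → colClause i ∈ φ
  colClause∈ i = ∈-++⁺ʳ (tabulate rowClause) (∈-++⁺ˡ (∈-tabulate⁺ i))

  outputClause∈ : ∀ a → outputClause a ∈ φ
  outputClause∈ a =
    ∈-++⁺ʳ (tabulate rowClause)
      (∈-++⁺ʳ (tabulate colClause) (∈-++⁺ˡ (∈-tabulate⁺ {f = outputClause} a)))

  rowsAtMostOne⊆ : rowsAtMostOne ⊆ φ
  rowsAtMostOne⊆ = ∈-++⁺ʳ (tabulate rowClause) ∘ ∈-++⁺ʳ (tabulate colClause)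
                 ∘ ∈-++⁺ʳ (tabulate outputClause) ∘ ∈-++⁺ˡ

  colsAtMostOne⊆ : colsAtMostOne ⊆ φ
  colsAtMostOne⊆ = ∈-++⁺ʳ (tabulate rowClause) ∘ ∈-++⁺ʳ (tabulate colClause)
                 ∘ ∈-++⁺ʳ (tabulate outputClause) ∘ ∈-++⁺ʳ rowsAtMostOne

  length-φ : length φ ≡ 2 * n + (3 + 7 * k′)
  length-φ = trans blocks (count n k′)
    where
    blocks : length φ ≡ n + (n + (suc k′ + (suc (3 * k′) + suc (3 * k′))))
    blocks =
      trans (length-++ (tabulate rowClause)) (cong₂ _+_ (length-tabulate rowClause)
      (trans (length-++ (tabulate colClause)) (cong₂ _+_ (length-tabulate colClause)
      (trans (length-++ (tabulate outputClause)) (cong₂ _+_ (length-tabulate outputClause)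
      (trans (length-++ rowsAtMostOne)
             (cong₂ _+_ (length-sequential k′ rowVar rowSuffix) (length-sequential k′ colVar colSuffix))))))))
    count : ∀ n k′ → n + (n + (suc k′ + (suc (3 * k′) + suc (3 * k′)))) ≡ 2 * n + (3 + 7 * k′)
    count = solve-∀

  auxiliary-bound : 4 * suc k′ ≤ 8 * suc k′
  auxiliary-bound = *-monoˡ-≤ (suc k′) (m≤m+n 4 4)

  excess-bound : length φ ∸ 2 * n ≤ 8 * suc k′
  excess-bound = begin
    length φ ∸ 2 * n              ≡⟨ cong (_∸ 2 * n) length-φ ⟩
    2 * n + (3 + 7 * k′) ∸ 2 * n  ≡⟨ m+n∸m≡n (2 * n) _ ⟩
    3 + 7 * k′                    ≤⟨ m≤m+n _ (5 + k′) ⟩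
    3 + 7 * k′ + (5 + k′)         ≡⟨ slack k′ ⟩
    8 * suc k′                    ∎
    where
    open ≤-Reasoning
    slack : ∀ k′ → 3 + 7 * k′ + (5 + k′) ≡ 8 * suc k′
    slack = solve-∀

  auxBits : (InVar n → Bool) → Fin 4 → Fin (suc k′) → Bool
  auxBits τ F.zero                         = hits (τ ∘ x) row
  auxBits τ (F.suc F.zero)                 = hits (τ ∘ x) col
  auxBits τ (F.suc (F.suc F.zero))         = suffixAny (hits (τ ∘ x) row)
  auxBits τ (F.suc (F.suc (F.suc F.zero))) = suffixAny (hits (τ ∘ x) col)

  auxModel : (InVar n → Bool) → Fin (4 * suc k′) → Bool
  auxModel τ = uncurry (auxBits τ) ∘ F.remQuot (suc k′)

  auxVar-value : ∀ τ g a → [ τ , auxModel τ ] (auxVar g a) ≡ auxBits τ g a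
  auxVar-value τ g a = cong (uncurry (auxBits τ)) (Fin.remQuot-combine g a)

  extend : ∀ τ → AtMostOne′ n τ → Sat [ τ , auxModel τ ] φ
  extend τ (at-most-one , implies-z) =
    all⇒sat (All.++⁺ rows (All.++⁺ cols (All.++⁺ outputs (All.++⁺ rows-atMostOne cols-atMostOne))))
    where
    γ : Var → Bool
    γ = [ τ , auxModel τ ]
    value : ∀ g a → γ (auxVar g a) ≡ auxBits τ g a
    value = auxVar-value τ
    rows : All (SatClause γ) (tabulate rowClause)
    rows = All.tabulate⁺ λ i → implication-holds (trans (value (# 0) (row i)) ∘ hits-intro (τ ∘ x) row i)
    cols : All (SatClause γ) (tabulate colClause)
    cols = All.tabulate⁺ λ i → implication-holds (trans (value (# 1) (col i)) ∘ hits-intro (τ ∘ x) col i)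
    outputs : All (SatClause γ) (tabulate outputClause)
    outputs = All.tabulate⁺ {f = outputClause} λ a → implication-holds λ e →
      let i , τi , _ = hits-elim (τ ∘ x) row (trans (sym (value (# 0) a)) e) in implies-z i τi
    rows-atMostOne : All (SatClause γ) rowsAtMostOne
    rows-atMostOne = sequential-sat rowVar rowSuffix (hits (τ ∘ x) row) (value (# 0))
                       (hits-atMostOne (τ ∘ x) row at-most-one) (value (# 2))
    cols-atMostOne : All (SatClause γ) colsAtMostOne
    cols-atMostOne = sequential-sat colVar colSuffix (hits (τ ∘ x) col) (value (# 1))
                       (hits-atMostOne (τ ∘ x) col at-most-one) (value (# 3))

  module Propagation {ψ : CNF Var} (φ⊆ψ : φ ⊆ ψ) where

    input⇒output : ∀ {i} → UPDerives ψ (pos (input i)) → UPDerives ψ (pos output)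
    input⇒output {i} d =
      propagateʳ (φ⊆ψ (outputClause∈ (row i))) (propagateʳ (φ⊆ψ (rowClause∈ i)) d)

    ¬output⇒¬input : UPDerives ψ (neg output) → ∀ j → UPDerives ψ (neg (input j))
    ¬output⇒¬input d j =
      propagateˡ (φ⊆ψ (rowClause∈ j)) (propagateˡ (φ⊆ψ (outputClause∈ (row j))) d)

    input⇒¬input : ∀ {i j} → i ≢ j → UPDerives ψ (pos (input i)) → UPDerives ψ (neg (input j))
    input⇒¬input {i} {j} i≢j d with row i F.≟ row j
    ... | no rows≢ = propagateˡ (φ⊆ψ (rowClause∈ j))
          (sequential-atMostOne rowVar rowSuffix (φ⊆ψ ∘ rowsAtMostOne⊆) rows≢
            (propagateʳ (φ⊆ψ (rowClause∈ i)) d))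
    ... | yes rows≡ = propagateˡ (φ⊆ψ (colClause∈ j))
          (sequential-atMostOne colVar colSuffix (φ⊆ψ ∘ colsAtMostOne⊆) cols≢
            (propagateʳ (φ⊆ψ (colClause∈ i)) d))
      where
      cols≢ : col i ≢ col j
      cols≢ cols≡ = i≢j (cell-injective (×-≡,≡→≡ (rows≡ , cols≡)))

  open Incompatibility (Incompatible {n}) using (PropagatesIncompatibility; models-consistent)

  incompatibility-propagates : PropagatesIncompatibility φ
  incompatibility-propagates ls {pos (x i)} {pos (x j)} i≢j d = input⇒¬input i≢j d
    where open Propagation {assume φ ls} ∈-++⁺ˡ
  incompatibility-propagates ls {pos (x i)} {neg (x i)} refl d = d
  incompatibility-propagates ls {neg (x i)} {pos (x i)} refl d = d
  incompatibility-propagates ls {pos (x i)} {neg z}     _    d = input⇒output d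
    where open Propagation {assume φ ls} ∈-++⁺ˡ
  incompatibility-propagates ls {neg z}     {pos (x i)} _    d = ¬output⇒¬input d i
    where open Propagation {assume φ ls} ∈-++⁺ˡ
  incompatibility-propagates ls {pos z}     {neg z}     _    d = d
  incompatibility-propagates ls {neg z}     {pos z}     _    d = d

  encodes : Encodes φ (AtMostOne′ n)
  encodes = encodes-byModels (λ τ τ⊨ → auxModel τ , extend τ τ⊨)
    (λ _ _ s → consistent⇒atMostOne′ (models-consistent incompatibility-propagates s))

  propagationComplete : PropagationComplete φ
  propagationComplete = Incompatibility.propagationComplete Incompatible incompatibility-propagates
    encodes incompatible-irrefl incompatible-sym incompatiblePair-or-model

squareBetween : ∀ n → ∃[ k′ ] (suc n ≤ suc k′ * suc k′ × suc k′ * suc k′ ≤ 4 * suc n)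
squareBetween zero = 0 , s≤s z≤n , s≤s z≤n
squareBetween (suc n) with squareBetween n
... | k′ , lower , upper with suc (suc n) ≤? suc k′ * suc k′
...   | yes lower′  = k′ , lower′ , ≤-trans upper (*-monoʳ-≤ 4 (n≤1+n (suc n)))
...   | no  ¬lower′ = suc k′ , next-lower , next-upper
  where
  open ≤-Reasoning
  exact : suc k′ * suc k′ ≡ suc n
  exact = ≤-antisym (s≤s⁻¹ (≰⇒> ¬lower′)) lower
  step : ∀ k′ → suc (suc k′) * suc (suc k′) ≡ suc (suc k′ * suc k′) + (2 + 2 * k′)
  step = solve-∀
  doubling : ∀ k′ →
    4 * (suc k′ * suc k′) ≡ suc (suc k′) * suc (suc k′) + (3 * (k′ * k′) + 4 * k′)
  doubling = solve-∀
  next-lower : suc (suc n) ≤ suc (suc k′) * suc (suc k′)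
  next-lower = begin
    suc (suc n)                           ≡⟨ cong suc exact ⟨
    suc (suc k′ * suc k′)                 ≤⟨ m≤m+n _ _ ⟩
    suc (suc k′ * suc k′) + (2 + 2 * k′)  ≡⟨ step k′ ⟨
    suc (suc k′) * suc (suc k′)           ∎
  next-upper : suc (suc k′) * suc (suc k′) ≤ 4 * suc (suc n)
  next-upper = begin
    suc (suc k′) * suc (suc k′)                             ≤⟨ m≤m+n _ _ ⟩
    suc (suc k′) * suc (suc k′) + (3 * (k′ * k′) + 4 * k′)  ≡⟨ doubling k′ ⟨
    4 * (suc k′ * suc k′)                                   ≡⟨ cong (4 *_) exact ⟩
    4 * suc n                                               ≤⟨ *-monoʳ-≤ 4 (n≤1+n (suc n)) ⟩
    4 * suc (suc n)                                         ∎

gridCell : ∀ {n k} → n ≤ k * k → Σ (Fin n → Fin k × Fin k) (Injective _≡_ _≡_)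
gridCell {n} {k} n≤k² = cell , λ {i} {j} cells≡ → Fin.inject≤-injective n≤k² n≤k² i j
  (trans (sym (Fin.combine-remQuot {k} k _))
         (trans (cong (uncurry F.combine) cells≡) (Fin.combine-remQuot {k} k _)))
  where
  cell : Fin n → Fin k × Fin k
  cell i = F.remQuot k (F.inject≤ i n≤k²)

square-bound : ∀ {n k c} → k * k ≤ 4 * n → c ≤ 8 * k → c * c ≤ 16 * 16 * n
square-bound {n} {k} {c} k²≤4n c≤8k = begin
  c * c            ≤⟨ *-mono-≤ c≤8k c≤8k ⟩
  8 * k * (8 * k)  ≡⟨ square k ⟩
  64 * (k * k)     ≤⟨ *-monoʳ-≤ 64 k²≤4n ⟩
  64 * (4 * n)     ≡⟨ scale n ⟩
  16 * 16 * n      ∎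
  where
  open ≤-Reasoning
  square : ∀ k → 8 * k * (8 * k) ≡ 64 * (k * k)
  square = solve-∀
  scale : ∀ n → 64 * (4 * n) ≡ 16 * 16 * n
  scale = solve-∀

lemma7 : ∃[ C ] ∃[ N ] ((n : ℕ) → N ≤ n →
    ∃[ m ] Σ (CNF (InVar n ⊎ Fin m)) λ φ →
    Encodes φ (AtMostOne′ n) × PropagationComplete φ ×
    (m * m ≤ C * C * n) ×
    ((length φ ∸ 2 * n) * (length φ ∸ 2 * n) ≤ C * C * n))
lemma7 = 16 , 1 , λ where
  (suc n) _ →
    let k′ , n<k² , k²≤4n = squareBetween n
        cell , cell-injective = gridCell n<k²
        open GridEncoding cell cell-injective
    in 4 * suc k′ , φ , encodes , propagationComplete ,
       square-bound {suc n} k²≤4n auxiliary-bound , square-bound {suc n} k²≤4n excess-bound
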